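{- Let $p$ and $q$ be distinct odd primes with $p<q$, and let $m=\big\lfloor\frac{q-p}{2p}\big\rfloor$. Then $$\sum_{i=\frac{q-1}{2}-m}^{\frac{q-1}{2}}\Big\lfloor\frac{ip}{q}\Big\rfloor=\Big(\frac{p-1}{2}\Big)(m+1).$$
   Context: $\lfloor t\rfloor$ denotes the greatest integer less than or equal to $t$. -}

module Defs where

open import Data.Nat using (ℕ; zero; suc; _+_)

-- sumFromTo a b f = Σ_{i=a}^{b} f i  (empty, i.e. 0, when b < a)
sumRange : ℕ → ℕ → (ℕ → ℕ) → ℕ
sumRange a zero    f = 0
sumRange a (suc k) f = f a + sumRange (suc a) k f

sumFromTo : ℕ → ℕ → (ℕ → ℕ) → ℕ
sumFromTo a b f = sumRange a (suc b Data.Nat.∸ a) f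

-- ⌊ a / b ⌋ for natural numbers; only used here with b > 0
-- (convention: value 0 when b = 0, never reached under the hypotheses).
fdiv : ℕ → ℕ → ℕ
fdiv a zero    = 0
fdiv a (suc b) = a Data.Nat./ suc b

{-# OPTIONS --safe #-}
module Submission where

-- Write p = 1 + 2h and q = 1 + 2k, so that (p-1)/2 = h, (q-1)/2 = k and m = ⌊(k-h)/p⌋,
-- whence m p + h ≤ k. Every i with k - m ≤ i ≤ k then satisfies h q ≤ i p < (h+1) q, so
-- each of the m + 1 summands ⌊i p / q⌋ equals h.

open import Defs
open import Data.Nat using (ℕ; zero; suc; _+_; _*_; _∸_; _<_; _≤_; _/_; _%_; NonZero; s≤s; s≤s⁻¹; z≤n)
open import Data.Nat.Properties
open import Data.Nat.DivMod using (m≡m%n+[m/n]*n; m*n/n≡m; m/n*n≤m; /-monoˡ-≤; m<n*o⇒m/o<n)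
open import Data.Nat.Primality using (Prime)
open import Data.Nat.Solver using (module +-*-Solver)
open import Data.Product using (∃; _,_)
open import Relation.Binary.PropositionalEquality
open +-*-Solver

sumRange-const : ∀ {c} a n f → (∀ i → a ≤ i → i < a + n → f i ≡ c) → sumRange a n f ≡ n * c
sumRange-const a zero    f f≡c = refl
sumRange-const a (suc n) f f≡c = cong₂ _+_
  (f≡c a ≤-refl (m<m+n a (s≤s z≤n)))
  (sumRange-const (suc a) n f λ i a<i i<a+1+n →
    f≡c i (<⇒≤ a<i) (subst (i <_) (sym (+-suc a n)) i<a+1+n))

sumFromTo-const : ∀ {c} a b f → a ≤ suc b → (∀ i → a ≤ i → i ≤ b → f i ≡ c) →
  sumFromTo a b f ≡ (suc b ∸ a) * c
sumFromTo-const a b f a≤1+b f≡c = sumRange-const a (suc b ∸ a) f λ i a≤i i<a+n →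
  f≡c i a≤i (s≤s⁻¹ (subst (i <_) (m+[n∸m]≡n a≤1+b) i<a+n))

/-unique : ∀ {h x} q .{{_ : NonZero q}} → h * q ≤ x → x < suc h * q → x / q ≡ h
/-unique {h} {x} q lower upper = ≤-antisym
  (s≤s⁻¹ (m<n*o⇒m/o<n {x} {suc h} {q} upper))
  (≤-trans (≤-reflexive (sym (m*n/n≡m h q))) (/-monoˡ-≤ q lower))

%2≡1⇒≡1+h*2 : ∀ {p} → p % 2 ≡ 1 → ∃ λ h → p ≡ suc (h * 2)
%2≡1⇒≡1+h*2 {p} p%2≡1 = p / 2 , trans (m≡m%n+[m/n]*n p 2) (cong (_+ p / 2 * 2) p%2≡1)

n*2/2≡n : ∀ n → n * 2 / 2 ≡ n
n*2/2≡n n = m*n/n≡m n 2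

module _ (h k : ℕ) where

  private
    p q : ℕ
    p = suc (h * 2)
    q = suc (k * 2)

  i*p<[1+h]*q : ∀ {i} → i ≤ k → i * p < suc h * q
  i*p<[1+h]*q {i} i≤k = begin-strict
    i * p                   ≤⟨ *-monoˡ-≤ p i≤k ⟩
    k * p                   <⟨ s≤s (m≤m+n (k * p) (h + k)) ⟩
    suc (k * p + (h + k))   ≡⟨ solve 2 (λ h k → con 1 :+ (k :* (con 1 :+ h :* con 2) :+ (h :+ k))
                                                := (con 1 :+ h) :* (con 1 :+ k :* con 2)) refl h k ⟩
    suc h * q               ∎
    where open ≤-Reasoning

  h*q≤i*p : ∀ {i m} → m * p + h ≤ k → k ≤ i + m → h * q ≤ i * p
  h*q≤i*p {i} {m} mp+h≤k k≤i+m = +-cancelˡ-≤ (m * p) (h * q) (i * p) (begin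
    m * p + h * q           ≡⟨ solve 3 (λ h k m → m :* (con 1 :+ h :* con 2) :+ h :* (con 1 :+ k :* con 2)
                                                := (m :* (con 1 :+ h :* con 2) :+ h) :+ k :* (h :* con 2)) refl h k m ⟩
    (m * p + h) + k * (h * 2) ≤⟨ +-monoˡ-≤ (k * (h * 2)) mp+h≤k ⟩
    k + k * (h * 2)         ≡⟨ solve 2 (λ h k → k :+ k :* (h :* con 2) := k :* (con 1 :+ h :* con 2)) refl h k ⟩
    k * p                   ≤⟨ *-monoˡ-≤ p k≤i+m ⟩
    (i + m) * p             ≡⟨ solve 3 (λ h i m → (i :+ m) :* (con 1 :+ h :* con 2)
                                                := m :* (con 1 :+ h :* con 2) :+ i :* (con 1 :+ h :* con 2)) refl h i m ⟩
    m * p + i * p           ∎)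
    where open ≤-Reasoning

  floor-slope-sum : ∀ m → m * p + h ≤ k → sumFromTo (k ∸ m) k (λ i → fdiv (i * p) q) ≡ h * (m + 1)
  floor-slope-sum m mp+h≤k = begin
    sumFromTo (k ∸ m) k (λ i → fdiv (i * p) q) ≡⟨ sumFromTo-const (k ∸ m) k _ (m≤n⇒m≤1+n (m∸n≤m k m)) floor≡h ⟩
    (suc k ∸ (k ∸ m)) * h                     ≡⟨ cong (_* h) (+-∸-assoc 1 (m∸n≤m k m)) ⟩
    suc (k ∸ (k ∸ m)) * h                     ≡⟨ cong (λ n → suc n * h) (m∸[m∸n]≡n m≤k) ⟩
    suc m * h                                 ≡⟨ *-comm (suc m) h ⟩
    h * suc m                                 ≡⟨ cong (h *_) (+-comm 1 m) ⟩
    h * (m + 1)                               ∎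
    where
    open ≡-Reasoning
    m≤k : m ≤ k
    m≤k = ≤-trans (m≤m*n m p) (≤-trans (m≤m+n (m * p) h) mp+h≤k)
    floor≡h : ∀ i → k ∸ m ≤ i → i ≤ k → fdiv (i * p) q ≡ h
    floor≡h i k-m≤i i≤k = /-unique q
      (h*q≤i*p {i} {m} mp+h≤k (≤-trans (≤-reflexive (sym (m∸n+n≡m m≤k))) (+-monoˡ-≤ m k-m≤i)))
      (i*p<[1+h]*q {i} i≤k)

  fdiv[q∸p,2p]*p+h≤k : p < q → fdiv (q ∸ p) (2 * p) * p + h ≤ k
  fdiv[q∸p,2p]*p+h≤k p<q = begin
    m * p + h        ≤⟨ +-monoˡ-≤ h (*-cancelʳ-≤ (m * p) (k ∸ h) 2 mp*2≤[k∸h]*2) ⟩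
    (k ∸ h) + h      ≡⟨ m∸n+n≡m h≤k ⟩
    k                ∎
    where
    open ≤-Reasoning
    h≤k : h ≤ k
    h≤k = *-cancelʳ-≤ h k 2 (<⇒≤ (s≤s⁻¹ p<q))
    m : ℕ
    m = fdiv (q ∸ p) (2 * p)
    mp*2≤[k∸h]*2 : m * p * 2 ≤ (k ∸ h) * 2
    mp*2≤[k∸h]*2 = begin
      m * p * 2         ≡⟨ solve 2 (λ m p → m :* p :* con 2 := m :* (con 2 :* p)) refl m p ⟩
      m * (2 * p)       ≤⟨ m/n*n≤m (k * 2 ∸ h * 2) (2 * p) ⟩
      k * 2 ∸ h * 2     ≡⟨ *-distribʳ-∸ 2 k h ⟨
      (k ∸ h) * 2       ∎

theorem13 : (p q : ℕ) → Prime p → Prime q → p % 2 ≡ 1 → q % 2 ≡ 1 → p < q →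
    let m = fdiv (q ∸ p) (2 * p) in
    sumFromTo ((q ∸ 1) / 2 ∸ m) ((q ∸ 1) / 2) (λ i → fdiv (i * p) q)
      ≡ ((p ∸ 1) / 2) * (m + 1)
theorem13 p q _ _ p-odd q-odd p<q with %2≡1⇒≡1+h*2 {p} p-odd | %2≡1⇒≡1+h*2 {q} q-odd
... | h , refl | k , refl rewrite n*2/2≡n h | n*2/2≡n k =
  floor-slope-sum h k _ (fdiv[q∸p,2p]*p+h≤k h k p<q)
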